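{- Let $m\ge 1$ and let $v=v_1*v_2$ be a non-empty $m$-Dyck path with $v_1,v_2$ non-empty. If $v\triangleleft w$ is a greedy cover relation, then either $w=w_1*v_2$ where $v_1\triangleleft w_1$, or $w=v_1*w_2$ where $v_2\triangleleft w_2$. Conversely, every greedy cover relation $v_1\triangleleft w_1$ gives a greedy cover relation $v_1*v_2\triangleleft w_1*v_2$, and every greedy cover relation $v_2\triangleleft w_2$ gives a greedy cover relation $v_1*v_2\triangleleft v_1*w_2$. Consequently, the upper ideal $\{w: v\le w\}$ in the greedy order equals $\{w_1*w_2 : v_1\le w_1 \text{ and } v_2\le w_2\}$.
   Context: An $m$-Dyck path of size $n$ is a word with $n$ letters $1$ (up steps $(+m,+m)$) and $mn$ letters $0$ (down steps $(+1,-1)$) whose lattice path from $(0,0)$ never goes strictly below the horizontal axis. A valley is an occurrence of the factor $01$; a Dyck factor is a factor which is itself an $m$-Dyck path. The greedy $m$-Tamari order (on paths of a fixed size) is generated by the cover relations $w\triangleleft w'$, one per valley of $w$, where $w'$ is obtained by swapping the down step of the valley with the longest Dyck factor immediately following it. For non-empty paths $w_1,w_2$, $w_1*w_2$ is the path obtained from $w_1$ by replacing its rightmost peak (the last occurrence of the factor $10^m$) by $w_2$. -}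

module Defs where

open import Data.Nat using (ℕ; zero; suc; _+_; _*_; _≤_)
open import Data.List using (List; []; _∷_; _++_; length; reverse; replicate)
open import Data.Maybe using (Maybe; just; nothing)
open import Data.Product using (Σ; ∃; ∃-syntax; _×_; _,_)
open import Relation.Binary.PropositionalEquality using (_≡_)
open import Relation.Binary.Construct.Closure.ReflexiveTransitive using (Star)

-- Letters: U = 1 (up step (+m,+m)), D = 0 (down step (+1,-1)).
data Step : Set where
  U D : Step

#U : List Step → ℕ
#U []      = 0
#U (U ∷ w) = suc (#U w)
#U (D ∷ w) = #U w

#D : List Step → ℕ
#D []      = 0
#D (U ∷ w) = #D w
#D (D ∷ w) = suc (#D w)

IsDyck : ℕ → List Step → Set
IsDyck m w = (#D w ≡ m * #U w)
           × (∀ p s → w ≡ p ++ s → #D p ≤ m * #U p)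

-- Greedy cover relation v ◁ w: v is an m-Dyck path, v = p · 0 · 1r has a
-- valley (factor 01) at that position, u is the longest Dyck factor
-- immediately following the down step of the valley (longest Dyck prefix of
-- 1r), and w is obtained by swapping that down step with u.
Cover : ℕ → List Step → List Step → Set
Cover m v w =
  IsDyck m v ×
  ∃[ p ] ∃[ r ] ∃[ u ] ∃[ s ]
    ( v ≡ p ++ D ∷ U ∷ r
    × U ∷ r ≡ u ++ s
    × IsDyck m u
    × (∀ u′ s′ → U ∷ r ≡ u′ ++ s′ → IsDyck m u′ → length u′ ≤ length u)
    × w ≡ p ++ u ++ D ∷ s )

_≤[_]_ : List Step → ℕ → List Step → Set
v ≤[ m ] w = Star (Cover m) v w

stripPrefix : List Step → List Step → Maybe (List Step)
stripPrefix []      l       = just l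
stripPrefix (x ∷ p) []      = nothing
stripPrefix (U ∷ p) (U ∷ l) = stripPrefix p l
stripPrefix (D ∷ p) (D ∷ l) = stripPrefix p l
stripPrefix (U ∷ p) (D ∷ l) = nothing
stripPrefix (D ∷ p) (U ∷ l) = nothing

replaceFirst : List Step → List Step → List Step → List Step
replaceFirst pat rep l with stripPrefix pat l
... | just rest = rep ++ rest
replaceFirst pat rep []      | nothing = []
replaceFirst pat rep (x ∷ l) | nothing = x ∷ replaceFirst pat rep l

-- w₁ * w₂ : replace the rightmost peak (last occurrence of the factor 10^m)
-- of w₁ by w₂.  (Last occurrence in w₁ = first occurrence of the reversed
-- factor in reverse w₁.)
ins : ℕ → List Step → List Step → List Step
ins m w₁ w₂ =
  reverse (replaceFirst (reverse (U ∷ replicate m D)) (reverse w₂) (reverse w₁))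

-- Write v₁ = a 1 0^m 0^k with its rightmost peak exposed, so that v₁ * v₂ = a v₂ 0^k.
-- A valley of a word a d 0^k, with d a non-empty Dyck path, lies either inside d or
-- inside a.  In the first case the longest Dyck factor after it cannot run into the
-- trailing 0^k, because d returns to the axis right after it; so the cover happens
-- inside d.  In the second case the word after the valley's down step is c d 0^k, and
-- its longest Dyck prefix is either a prefix of c (when c never ends at a height
-- j ≤ k) or c d 0^j (when c ends at height j).  Both descriptions are uniform in d, so
-- the greedy swap commutes with exchanging d between the peak 1 0^m and v₂.

module Submission where

open import Defs
open import Data.Nat using (ℕ; zero; suc; _+_; _*_; _≤_; _<_; z≤n; s≤s; s≤s⁻¹)
open import Data.Nat.Properties
  using (+-comm; +-assoc; +-suc; *-zeroʳ; +-identityʳ; suc-injective; m+n≡0⇒n≡0; ≤-trans; ≤-reflexive;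
         ≤-antisym; <⇒≱; ≤-<-trans; +-monoʳ-≤)
open import Data.Nat.Tactic.RingSolver using (solve-∀)
open import Data.List using (List; []; _∷_; _++_; _∷ʳ_; length; reverse; replicate)
open import Data.List.Properties
  using (++-assoc; length-++; length-++-≤ˡ; ∷-injective; ∷-injectiveʳ; ++-conicalʳ;
         reverse-++; reverse-involutive; unfold-reverse)
open import Data.Maybe using (just; nothing)
open import Data.Product using (∃-syntax; _×_; _,_)
open import Data.Sum using (_⊎_; inj₁; inj₂)
open import Data.Empty using (⊥; ⊥-elim)
open import Relation.Nullary using (¬_)
open import Relation.Binary.PropositionalEquality
open import Relation.Binary.Construct.Closure.ReflexiveTransitive using (Star; ε; _◅_; _◅◅_)

++-equidivisible : ∀ {A : Set} (p a : List A) {x y : List A} → p ++ x ≡ a ++ y →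
  (∃[ t ] (a ≡ p ++ t × x ≡ t ++ y)) ⊎ (∃[ z ] ∃[ t ] (p ≡ a ++ z ∷ t × y ≡ z ∷ t ++ x))
++-equidivisible []      a        eq = inj₁ (a , refl , eq)
++-equidivisible (z ∷ p) []       eq = inj₂ (z , p , refl , sym eq)
++-equidivisible (z ∷ p) (z′ ∷ a) eq with ∷-injective eq
... | refl , eq′ with ++-equidivisible p a eq′
...   | inj₁ (t , e₁ , e₂)      = inj₁ (t , cong (z ∷_) e₁ , e₂)
...   | inj₂ (z″ , t , e₁ , e₂) = inj₂ (z″ , t , cong (z ∷_) e₁ , e₂)

++-cancel-≡length : ∀ {A : Set} (x y : List A) {s s′ : List A} →
  x ++ s ≡ y ++ s′ → length x ≡ length y → x ≡ y × s ≡ s′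
++-cancel-≡length []      []      eq _  = refl , eq
++-cancel-≡length (a ∷ x) (b ∷ y) eq le with ∷-injective eq
... | refl , eq′ with ++-cancel-≡length x y eq′ (suc-injective le)
...   | refl , e = refl , e

prefix-length≤ : ∀ {A : Set} {x : List A} y {t : List A} → x ≡ y ++ t → length y ≤ length x
prefix-length≤ y refl = length-++-≤ˡ y

length-++-monoʳ : ∀ {A : Set} (c : List A) {z z′ : List A} →
  length z ≤ length z′ → length (c ++ z) ≤ length (c ++ z′)
length-++-monoʳ c {z} {z′} le =
  subst₂ _≤_ (sym (length-++ c)) (sym (length-++ c)) (+-monoʳ-≤ (length c) le)

length-<-++-∷ : ∀ {A : Set} (c : List A) {x : A} {X : List A} → length c < length (c ++ x ∷ X)
length-<-++-∷ []      = s≤s z≤n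
length-<-++-∷ (_ ∷ c) = s≤s (length-<-++-∷ c)

head-preserved : ∀ {A : Set} {x : A} (c : List A) {r X : List A} (Y : List A) →
  x ∷ r ≡ c ++ x ∷ X → ∃[ r′ ] (c ++ x ∷ Y ≡ x ∷ r′)
head-preserved []      Y _  = Y , refl
head-preserved (_ ∷ c) Y eq with ∷-injective eq
... | refl , _ = c ++ _ ∷ Y , refl

replicate-++ : ∀ {A : Set} j i (x : A) → replicate j x ++ replicate i x ≡ replicate (j + i) x
replicate-++ zero    i x = refl
replicate-++ (suc j) i x = cong (x ∷_) (replicate-++ j i x)

replicate-++⁻ : ∀ {A : Set} {x : A} (a b : List A) k → a ++ b ≡ replicate k x →
  ∃[ j ] ∃[ i ] (a ≡ replicate j x × b ≡ replicate i x × k ≡ j + i)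
replicate-++⁻ []      b k       eq = 0 , k , refl , eq , refl
replicate-++⁻ (_ ∷ a) b (suc k) eq with ∷-injective eq
... | refl , eq′ with replicate-++⁻ a b k eq′
...   | j , i , e₁ , e₂ , e₃ = suc j , i , cong (_ ∷_) e₁ , e₂ , cong suc e₃

replicate-head : ∀ {A : Set} {x z : A} {k t} → replicate k x ≡ z ∷ t → z ≡ x
replicate-head {k = suc k} refl = refl

reverse-replicate : ∀ {A : Set} n (x : A) → reverse (replicate n x) ≡ replicate n x
reverse-replicate zero    x = refl
reverse-replicate (suc n) x = begin
  reverse (x ∷ replicate n x)   ≡⟨ unfold-reverse x (replicate n x) ⟩
  reverse (replicate n x) ∷ʳ x  ≡⟨ cong (_∷ʳ x) (reverse-replicate n x) ⟩
  replicate n x ∷ʳ x            ≡⟨ replicate-++ n 1 x ⟩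
  replicate (n + 1) x           ≡⟨ cong (λ l → replicate l x) (+-comm n 1) ⟩
  x ∷ replicate n x             ∎
  where open ≡-Reasoning

D^_ : ℕ → List Step
D^ n = replicate n D

U∉D^ : ∀ n t r → D^ n ≢ t ++ U ∷ r
U∉D^ zero    []      r ()
U∉D^ zero    (_ ∷ t) r ()
U∉D^ (suc n) []      r ()
U∉D^ (suc n) (U ∷ t) r ()
U∉D^ (suc n) (D ∷ t) r eq = U∉D^ n t r (∷-injectiveʳ eq)

U∷D^-has-no-valley : ∀ n q {r} → U ∷ D^ n ≢ q ++ D ∷ U ∷ r
U∷D^-has-no-valley n []      ()
U∷D^-has-no-valley n (D ∷ q) ()
U∷D^-has-no-valley n (U ∷ q) {r} eq =
  U∉D^ n (q ∷ʳ D) r (trans (∷-injectiveʳ eq) (sym (++-assoc q (D ∷ []) (U ∷ r))))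

valley-++-D^ : ∀ v q {r} k → v ++ D^ k ≡ q ++ D ∷ U ∷ r →
  ∃[ r′ ] (v ≡ q ++ D ∷ U ∷ r′ × r ≡ r′ ++ D^ k)
valley-++-D^ v q {r} k eq with ++-equidivisible v q eq
... | inj₁ (t , _ , e) = ⊥-elim (U∉D^ k (t ∷ʳ D) r (trans e (sym (++-assoc t (D ∷ []) (U ∷ r)))))
... | inj₂ (_ , []     , _ , e)       = ⊥-elim (U∉D^ k [] r (sym (∷-injectiveʳ e)))
... | inj₂ (_ , U ∷ r′ , refl , refl) = r′ , refl , refl
... | inj₂ (_ , D ∷ _  , _ , ())

Grafted : List Step → List Step → ℕ → List Step
Grafted d a k = a ++ d ++ D^ k

Regraft : List Step → List Step → List Step → List Step → Set
Regraft d d′ w w′ = ∃[ a ] ∃[ k ] (w ≡ Grafted d a k × w′ ≡ Grafted d′ a k)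

Regraft-sym : ∀ {d d′ w w′} → Regraft d d′ w w′ → Regraft d′ d w′ w
Regraft-sym (a , k , e , e′) = a , k , e′ , e

Regraft-++ˡ : ∀ {d d′ w w′} p → Regraft d d′ w w′ → Regraft d d′ (p ++ w) (p ++ w′)
Regraft-++ˡ {d} {d′} p (a , k , refl , refl) =
  p ++ a , k , sym (++-assoc p a (d ++ D^ k)) , sym (++-assoc p a (d′ ++ D^ k))

grafted-+ : ∀ d c j i → Grafted d c (j + i) ≡ (c ++ d ++ D^ j) ++ D^ i
grafted-+ d c j i = begin
  c ++ d ++ D^ (j + i)          ≡⟨ cong (λ x → c ++ d ++ x) (sym (replicate-++ j i D)) ⟩
  c ++ d ++ D^ j ++ D^ i        ≡⟨ cong (c ++_) (sym (++-assoc d (D^ j) (D^ i))) ⟩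
  c ++ (d ++ D^ j) ++ D^ i      ≡⟨ sym (++-assoc c (d ++ D^ j) (D^ i)) ⟩
  (c ++ d ++ D^ j) ++ D^ i      ∎
  where open ≡-Reasoning

grafted-swap : ∀ a q u s k → Grafted (q ++ u ++ D ∷ s) a k ≡ (a ++ q) ++ u ++ D ∷ s ++ D^ k
grafted-swap a q u s k = begin
  a ++ (q ++ u ++ D ∷ s) ++ D^ k    ≡⟨ cong (a ++_) (++-assoc q (u ++ D ∷ s) (D^ k)) ⟩
  a ++ q ++ (u ++ D ∷ s) ++ D^ k    ≡⟨ cong (λ x → a ++ q ++ x) (++-assoc u (D ∷ s) (D^ k)) ⟩
  a ++ q ++ u ++ D ∷ s ++ D^ k      ≡⟨ sym (++-assoc a q _) ⟩
  (a ++ q) ++ u ++ D ∷ s ++ D^ k    ∎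
  where open ≡-Reasoning

valley-grafted : ∀ d a p {r} k → Grafted d a k ≡ p ++ D ∷ U ∷ r →
    (∃[ c ] (a ≡ p ++ D ∷ c × U ∷ r ≡ Grafted d c k))
  ⊎ (∃[ q ] ∃[ r′ ] (p ≡ a ++ q × d ≡ q ++ D ∷ U ∷ r′ × r ≡ r′ ++ D^ k))
valley-grafted d a p k eq with ++-equidivisible a p eq
... | inj₁ (q , p≡ , e) with valley-++-D^ d q k e
...   | r′ , d≡ , r≡ = inj₂ (q , r′ , p≡ , d≡ , r≡)
valley-grafted d a p k eq | inj₂ (z , c , a≡ , e) with ∷-injective e
... | refl , e′ = inj₁ (c , a≡ , e′)

stripPrefix-hit : ∀ n rest → stripPrefix (D^ n ∷ʳ U) (D^ n ++ U ∷ rest) ≡ just rest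
stripPrefix-hit zero    rest = refl
stripPrefix-hit (suc n) rest = stripPrefix-hit n rest

stripPrefix-miss : ∀ n j rest → stripPrefix (D^ n ∷ʳ U) (D^ (suc j + n) ++ U ∷ rest) ≡ nothing
stripPrefix-miss zero    j rest = refl
stripPrefix-miss (suc n) j rest rewrite +-suc j n = stripPrefix-miss n j rest

replaceFirst-D^∷ʳU : ∀ n k rep rest →
  replaceFirst (D^ n ∷ʳ U) rep (D^ (k + n) ++ U ∷ rest) ≡ D^ k ++ rep ++ rest
replaceFirst-D^∷ʳU n zero    rep rest rewrite stripPrefix-hit n rest    = refl
replaceFirst-D^∷ʳU n (suc k) rep rest rewrite stripPrefix-miss n k rest =
  cong (D ∷_) (replaceFirst-D^∷ʳU n k rep rest)

-- In the reversed word the rightmost peak U D^m becomes the leftmost factor D^m U.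
ins-grafted : ∀ m a k x → ins m (Grafted (U ∷ D^ m) a k) x ≡ Grafted x a k
ins-grafted m a k x = begin
  reverse (replaceFirst (reverse (U ∷ D^ m)) (reverse x) (reverse (a ++ U ∷ D^ m ++ D^ k)))
    ≡⟨ cong₂ (λ pat l → reverse (replaceFirst pat (reverse x) l)) (reverse-peak m) reverse-word ⟩
  reverse (replaceFirst (D^ m ∷ʳ U) (reverse x) (D^ (k + m) ++ U ∷ reverse a))
    ≡⟨ cong reverse (replaceFirst-D^∷ʳU m k (reverse x) (reverse a)) ⟩
  reverse (D^ k ++ reverse x ++ reverse a)
    ≡⟨ cong (λ l → reverse (D^ k ++ l)) (sym (reverse-++ a x)) ⟩
  reverse (D^ k ++ reverse (a ++ x))
    ≡⟨ reverse-++ (D^ k) (reverse (a ++ x)) ⟩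
  reverse (reverse (a ++ x)) ++ reverse (D^ k)
    ≡⟨ cong₂ _++_ (reverse-involutive (a ++ x)) (reverse-replicate k D) ⟩
  (a ++ x) ++ D^ k
    ≡⟨ ++-assoc a x (D^ k) ⟩
  a ++ x ++ D^ k
    ∎
  where
  open ≡-Reasoning
  reverse-peak : ∀ n → reverse (U ∷ D^ n) ≡ D^ n ∷ʳ U
  reverse-peak n = trans (unfold-reverse U (D^ n)) (cong (_∷ʳ U) (reverse-replicate n D))
  reverse-word : reverse (a ++ U ∷ D^ m ++ D^ k) ≡ D^ (k + m) ++ U ∷ reverse a
  reverse-word = begin
    reverse (a ++ U ∷ D^ m ++ D^ k)     ≡⟨ cong (λ l → reverse (a ++ U ∷ l)) (replicate-++ m k D) ⟩
    reverse (a ++ U ∷ D^ (m + k))       ≡⟨ reverse-++ a (U ∷ D^ (m + k)) ⟩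
    reverse (U ∷ D^ (m + k)) ++ reverse a ≡⟨ cong (_++ reverse a) (reverse-peak (m + k)) ⟩
    (D^ (m + k) ∷ʳ U) ++ reverse a      ≡⟨ ++-assoc (D^ (m + k)) (U ∷ []) (reverse a) ⟩
    D^ (m + k) ++ U ∷ reverse a         ≡⟨ cong (λ l → D^ l ++ U ∷ reverse a) (+-comm m k) ⟩
    D^ (k + m) ++ U ∷ reverse a         ∎

module _ {A : Set} {R : A → A → Set} (P : A → Set) (R⇒P : ∀ {x y} → R x y → P y) (_∙_ : A → A → A) where

  star-preserves : ∀ {x y} → P x → Star R x y → P y
  star-preserves px ε        = px
  star-preserves _  (r ◅ rs) = star-preserves (R⇒P r) rs

  star-cong₂ : (∀ {x x′ y} → P x → P y → R x x′ → R (x ∙ y) (x′ ∙ y)) →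
               (∀ {x y y′} → P x → P y → R y y′ → R (x ∙ y) (x ∙ y′)) →
               ∀ {x x′ y y′} → P x → P y → Star R x x′ → Star R y y′ → Star R (x ∙ y) (x′ ∙ y′)
  star-cong₂ congˡ congʳ px py s₁ s₂ = starˡ px py s₁ ◅◅ starʳ (star-preserves px s₁) py s₂
    where
    starˡ : ∀ {x x′ y} → P x → P y → Star R x x′ → Star R (x ∙ y) (x′ ∙ y)
    starˡ px py ε        = ε
    starˡ px py (r ◅ rs) = congˡ px py r ◅ starˡ (R⇒P r) py rs
    starʳ : ∀ {x y y′} → P x → P y → Star R y y′ → Star R (x ∙ y) (x ∙ y′)
    starʳ px py ε        = ε
    starʳ px py (r ◅ rs) = congʳ px py r ◅ starʳ px (R⇒P r) rs

  star-decompose : (∀ {x y w} → P x → P y → R (x ∙ y) w →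
                      (∃[ x′ ] (R x x′ × w ≡ x′ ∙ y)) ⊎ (∃[ y′ ] (R y y′ × w ≡ x ∙ y′))) →
                   ∀ {x y w} → P x → P y → Star R (x ∙ y) w →
                   ∃[ x′ ] ∃[ y′ ] (Star R x x′ × Star R y y′ × w ≡ x′ ∙ y′)
  star-decompose split px py ε = _ , _ , ε , ε , refl
  star-decompose split px py (r ◅ rs) with split px py r
  ... | inj₁ (_ , r′ , refl) with star-decompose split (R⇒P r′) py rs
  ...   | x′ , y′ , s₁ , s₂ , e = x′ , y′ , r′ ◅ s₁ , s₂ , e
  star-decompose split px py (r ◅ rs) | inj₂ (_ , r′ , refl) with star-decompose split px (R⇒P r′) rs
  ...   | x′ , y′ , s₁ , s₂ , e = x′ , y′ , s₁ , r′ ◅ s₂ , e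

height-up : ∀ m h n → h + m * suc n ≡ m + h + m * n
height-up = solve-∀

module DyckPaths (m : ℕ) where

  -- Path h w h′: read from height h, w ends at height h′; heights are in ℕ, so it never dips below the axis.
  data Path : ℕ → List Step → ℕ → Set where
    nil  : ∀ {h} → Path h [] h
    up   : ∀ {h h′ w} → Path (m + h) w h′ → Path h (U ∷ w) h′
    down : ∀ {h h′ w} → Path h w h′ → Path (suc h) (D ∷ w) h′

  Dyck : List Step → Set
  Dyck w = Path 0 w 0

  path-++⁻ : ∀ x {y h h″} → Path h (x ++ y) h″ → ∃[ h′ ] (Path h x h′ × Path h′ y h″)
  path-++⁻ []      p        = _ , nil , p
  path-++⁻ (U ∷ x) (up p)   with path-++⁻ x p
  ... | h′ , px , py = h′ , up px , py
  path-++⁻ (D ∷ x) (down p) with path-++⁻ x p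
  ... | h′ , px , py = h′ , down px , py

  path-++⁺ : ∀ {x y h h′ h″} → Path h x h′ → Path h′ y h″ → Path h (x ++ y) h″
  path-++⁺ nil      q = q
  path-++⁺ (up p)   q = up (path-++⁺ p q)
  path-++⁺ (down p) q = down (path-++⁺ p q)

  path-functional : ∀ {x h h₁ h₂} → Path h x h₁ → Path h x h₂ → h₁ ≡ h₂
  path-functional nil      nil      = refl
  path-functional (up p)   (up q)   = path-functional p q
  path-functional (down p) (down q) = path-functional p q

  path-lift : ∀ n {x h h′} → Path h x h′ → Path (h + n) x (h′ + n)
  path-lift n nil = nil
  path-lift n {h = h} (up {h′ = h′} {w} p) =
    up (subst (λ g → Path g w (h′ + n)) (+-assoc m h n) (path-lift n p))
  path-lift n (down p) = down (path-lift n p)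

  path-D^ : ∀ j h → Path (j + h) (D^ j) h
  path-D^ zero    h = nil
  path-D^ (suc j) h = down (path-D^ j h)

  path-D^⁻ : ∀ j {h h′} → Path h (D^ j) h′ → h ≡ j + h′
  path-D^⁻ zero    nil      = refl
  path-D^⁻ (suc j) (down p) = cong suc (path-D^⁻ j p)

  dyck-++-D^ : ∀ {d} → Dyck d → ∀ j → Path j (d ++ D^ j) 0
  dyck-++-D^ dd j = path-++⁺ (path-lift j dd) (subst (λ h → Path h (D^ j) 0) (+-identityʳ j) (path-D^ j 0))

  dyck-++-D^⁻ : ∀ {d h} → Dyck d → ∀ j → Path h (d ++ D^ j) 0 → h ≡ j
  dyck-++-D^⁻ {d} {h} dd j p with path-++⁻ d p
  ... | g , pd , pj = trans (path-functional (path-lift h dd) pd) (trans (path-D^⁻ j pj) (+-identityʳ j))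

  peak : List Step
  peak = U ∷ D^ m

  peak-dyck : Dyck peak
  peak-dyck = up (path-D^ m 0)

  PrefixesAbove : ℕ → List Step → Set
  PrefixesAbove h w = ∀ p s → w ≡ p ++ s → #D p ≤ h + m * #U p

  path⇒balanced : ∀ {w h h′} → Path h w h′ → h + m * #U w ≡ h′ + #D w
  path⇒balanced {h = h} nil = cong (h +_) (*-zeroʳ m)
  path⇒balanced {U ∷ w} {h} (up p) = trans (height-up m h (#U w)) (path⇒balanced p)
  path⇒balanced {D ∷ w} {suc h} {h′} (down p) = trans (cong suc (path⇒balanced p)) (sym (+-suc h′ (#D w)))

  path⇒prefixesAbove : ∀ {w h h′} → Path h w h′ → PrefixesAbove h w
  path⇒prefixesAbove _               []      s e  = z≤n
  path⇒prefixesAbove {h = h} (up q)  (U ∷ p) s e  =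
    subst (#D p ≤_) (sym (height-up m h (#U p))) (path⇒prefixesAbove q p s (∷-injectiveʳ e))
  path⇒prefixesAbove (down q)        (D ∷ p) s e  = s≤s (path⇒prefixesAbove q p s (∷-injectiveʳ e))
  path⇒prefixesAbove nil             (_ ∷ p) s ()
  path⇒prefixesAbove (up q)          (D ∷ p) s ()
  path⇒prefixesAbove (down q)        (U ∷ p) s ()

  balanced⇒path : ∀ w {h h′} → h + m * #U w ≡ h′ + #D w → PrefixesAbove h w → Path h w h′
  balanced⇒path [] {h} {h′} eq _ = subst (Path h []) h≡h′ nil
    where
    h≡h′ : h ≡ h′
    h≡h′ = trans (sym (trans (cong (h +_) (*-zeroʳ m)) (+-identityʳ h))) (trans eq (+-identityʳ h′))
  balanced⇒path (U ∷ w) {h} eq above = up (balanced⇒path w (trans (sym (height-up m h (#U w))) eq) above′)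
    where
    above′ : PrefixesAbove (m + h) w
    above′ p s e = subst (#D p ≤_) (height-up m h (#U p)) (above (U ∷ p) s (cong (U ∷_) e))
  balanced⇒path (D ∷ w) {zero} eq above with subst (1 ≤_) (*-zeroʳ m) (above (D ∷ []) w refl)
  ... | ()
  balanced⇒path (D ∷ w) {suc h} {h′} eq above =
    down (balanced⇒path w (suc-injective (trans eq (+-suc h′ (#D w))))
                          (λ p s e → s≤s⁻¹ (above (D ∷ p) s (cong (D ∷_) e))))

  isDyck⇒dyck : ∀ {w} → IsDyck m w → Dyck w
  isDyck⇒dyck {w} (balanced , above) = balanced⇒path w (sym balanced) above

  dyck⇒isDyck : ∀ {w} → Dyck w → IsDyck m w
  dyck⇒isDyck p = sym (path⇒balanced p) , path⇒prefixesAbove p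

  dyck-head : ∀ {v} → Dyck v → v ≢ [] → ∃[ e ] (v ≡ U ∷ e)
  dyck-head nil    ne = ⊥-elim (ne refl)
  dyck-head (up _) _  = _ , refl

  last-U : ∀ w → (∃[ a ] ∃[ j ] (w ≡ a ++ U ∷ D^ j)) ⊎ (∃[ j ] (w ≡ D^ j))
  last-U [] = inj₂ (0 , refl)
  last-U (x ∷ w) with last-U w
  ... | inj₁ (a , j , e) = inj₁ (x ∷ a , j , cong (x ∷_) e)
  last-U (U ∷ w) | inj₂ (j , e) = inj₁ ([] , j , cong (U ∷_) e)
  last-U (D ∷ w) | inj₂ (j , e) = inj₂ (suc j , cong (D ∷_) e)

  last-peak : ∀ {v} → Dyck v → v ≢ [] → ∃[ a ] ∃[ k ] (v ≡ Grafted peak a k)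
  last-peak {v} dv ne with last-U v
  ... | inj₂ (zero , refl) = ⊥-elim (ne refl)
  last-peak () ne | inj₂ (suc j , refl)
  ... | inj₁ (a , j , refl) with path-++⁻ a dv
  ...   | k , _ , up pj = a , k , cong (λ l → a ++ U ∷ l) (trans (cong D^_ j≡m+k) (sym (replicate-++ m k D)))
    where
    j≡m+k : j ≡ m + k
    j≡m+k = sym (trans (path-D^⁻ j pj) (+-identityʳ j))

  -- X returns to the axis from height h, so read from the axis it ends no higher than 0,
  -- and no down step can follow it in a Dyck prefix.
  dyckPrefix-++-D^ : ∀ {X y t h} k → Path h X 0 → y ++ t ≡ X ++ D^ k → Dyck y →
    ∃[ t′ ] (X ≡ y ++ t′ × t ≡ t′ ++ D^ k)
  dyckPrefix-++-D^ {X} {y} {h = h} k pX eq dy with ++-equidivisible y X eq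
  ... | inj₁ within = within
  ... | inj₂ (z , t′ , refl , e) with replicate-head e | path-++⁻ X dy
  ...   | refl | _ , pX′ , down _ with path-functional pX (path-lift h pX′)
  ...     | ()

  DyckPrefixes≤ : List Step → ℕ → Set
  DyckPrefixes≤ x n = ∀ y t → x ≡ y ++ t → Dyck y → length y ≤ n

  LongestDyckPrefix : List Step → List Step → List Step → Set
  LongestDyckPrefix x u s = x ≡ u ++ s × Dyck u × DyckPrefixes≤ x (length u)

  longestDyckPrefix-unique : ∀ {x u s u′ s′} → LongestDyckPrefix x u s → LongestDyckPrefix x u′ s′ →
    u ≡ u′ × s ≡ s′
  longestDyckPrefix-unique {u = u} {s} {u′} {s′} (e , du , max) (e′ , du′ , max′) =
    ++-cancel-≡length u u′ (trans (sym e) e′) (≤-antisym (max′ u s e du) (max u′ s′ e′ du′))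

  longest-++-D^ : ∀ {X u s h} k → Path h X 0 → LongestDyckPrefix X u s →
    LongestDyckPrefix (X ++ D^ k) u (s ++ D^ k)
  longest-++-D^ {u = u} {s} k pX (refl , du , max) = ++-assoc u s (D^ k) , du , max′
    where
    max′ : DyckPrefixes≤ ((u ++ s) ++ D^ k) (length u)
    max′ y t e dy with dyckPrefix-++-D^ k pX (sym e) dy
    ... | t′ , e′ , _ = max y t′ e′ dy

  longest-++-D^⁻ : ∀ {X u s h} k → Path h X 0 → LongestDyckPrefix (X ++ D^ k) u s →
    ∃[ s′ ] (LongestDyckPrefix X u s′ × s ≡ s′ ++ D^ k)
  longest-++-D^⁻ {X} {u} k pX (e , du , max) with dyckPrefix-++-D^ k pX (sym e) du
  ... | s′ , e′ , s≡ = s′ , (e′ , du , max′) , s≡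
    where
    max′ : DyckPrefixes≤ X (length u)
    max′ y t e″ dy = max y (t ++ D^ k) (trans (cong (_++ D^ k) e″) (++-assoc y t (D^ k))) dy

  GreedyCover : List Step → List Step → Set
  GreedyCover v w = Dyck v × ∃[ p ] ∃[ r ] ∃[ u ] ∃[ s ]
    (v ≡ p ++ D ∷ U ∷ r × LongestDyckPrefix (U ∷ r) u s × w ≡ p ++ u ++ D ∷ s)

  cover⇒greedyCover : ∀ {v w} → Cover m v w → GreedyCover v w
  cover⇒greedyCover (dv , p , r , u , s , ev , eu , du , max , ew) =
    isDyck⇒dyck dv , p , r , u , s , ev , (eu , isDyck⇒dyck du , λ y t e dy → max y t e (dyck⇒isDyck dy)) , ew

  greedyCover⇒cover : ∀ {v w} → GreedyCover v w → Cover m v w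
  greedyCover⇒cover (dv , p , r , u , s , ev , (eu , du , max) , ew) =
    dyck⇒isDyck dv , p , r , u , s , ev , eu , dyck⇒isDyck du , (λ y t e dy → max y t e (isDyck⇒dyck dy)) , ew

  greedyCover-dyck : ∀ {v w} → GreedyCover v w → Dyck w
  greedyCover-dyck (dv , p , _ , u , _ , refl , (eu , du , _) , refl)
    with path-++⁻ p (subst (λ x → Dyck (p ++ D ∷ x)) eu dv)
  ... | suc h , pp , down pus with path-++⁻ u pus
  ...   | _ , pu , ps with path-functional (path-lift h du) pu
  ...     | refl = path-++⁺ pp (path-++⁺ (path-lift (suc h) du) (down ps))

  grafted-path : ∀ {d d′ a k} → Dyck (Grafted d a k) → Dyck d → Dyck d′ → Dyck (Grafted d′ a k)
  grafted-path {a = a} {k} dg dd dd′ with path-++⁻ a dg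
  ... | _ , pa , pdk with dyck-++-D^⁻ dd k pdk
  ...   | refl = path-++⁺ pa (dyck-++-D^ dd′ k)

  dyckPrefix-grafted : ∀ {d} c z {e k} → Dyck d → Dyck (c ++ z) → z ++ e ≡ d ++ D^ k →
    ∃[ j ] ∃[ i ] (k ≡ j + i × Path 0 c j × length z ≤ length (d ++ D^ j))
  dyckPrefix-grafted {d} c z {e} {k} dd dcz eq with path-++⁻ c dcz
  ... | h , pc , pz with ++-equidivisible z d eq
  ...   | inj₁ (t , refl , _) = 0 , k , refl , subst (Path 0 c) h≡0 pc , ≤-trans (length-++-≤ˡ z) (length-++-≤ˡ (z ++ t))
    where
    h≡0 : h ≡ 0
    h≡0 with path-++⁻ z dd
    ... | g , pz′ , _ = m+n≡0⇒n≡0 g (path-functional (path-lift h pz′) pz)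
  ...   | inj₂ (x , t , refl , e′) with replicate-++⁻ (x ∷ t) e k (sym e′)
  ...     | j , i , xt≡D^j , _ , refl =
    j , i , refl , subst (Path 0 c) (dyck-++-D^⁻ dd j (subst (λ l → Path h (d ++ l) 0) xt≡D^j pz)) pc ,
    ≤-reflexive (cong (λ l → length (d ++ l)) xt≡D^j)

  longest-grafted : ∀ {d c j i} → Dyck d → Path 0 c j →
    LongestDyckPrefix (Grafted d c (j + i)) (c ++ d ++ D^ j) (D^ i)
  longest-grafted {d} {c} {j} {i} dd pc = grafted-+ d c j i , path-++⁺ pc (dyck-++-D^ dd j) , max
    where
    max : DyckPrefixes≤ (Grafted d c (j + i)) (length (c ++ d ++ D^ j))
    max y t e dy with ++-equidivisible y c (sym e)
    ... | inj₁ (_ , c≡ , _) = ≤-trans (prefix-length≤ y c≡) (length-++-≤ˡ c)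
    ... | inj₂ (x , t′ , refl , e′) with dyckPrefix-grafted c (x ∷ t′) dd dy (sym e′)
    ...   | _ , _ , _ , pc′ , len rewrite path-functional pc′ pc = length-++-monoʳ c len

  ReturnsWithin : List Step → ℕ → Set
  ReturnsWithin c k = ∃[ j ] ∃[ i ] (k ≡ j + i × Path 0 c j)

  longest-inside⇒¬returns : ∀ {e u t k s} → Dyck (U ∷ e) →
    LongestDyckPrefix (Grafted (U ∷ e) (u ++ t) k) u s → ¬ ReturnsWithin (u ++ t) k
  longest-inside⇒¬returns {e} {u} {t} dd (_ , _ , max) (j , i , refl , pc) =
    <⇒≱ (≤-<-trans (length-++-≤ˡ u) (length-<-++-∷ (u ++ t)))
        (max _ (D^ i) (grafted-+ (U ∷ e) (u ++ t) j i) (path-++⁺ pc (dyck-++-D^ dd j)))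

  ¬returns⇒dyckPrefix-inside : ∀ {d c k y t} → ¬ ReturnsWithin c k → Dyck d →
    Grafted d c k ≡ y ++ t → Dyck y → ∃[ t′ ] (c ≡ y ++ t′)
  ¬returns⇒dyckPrefix-inside {c = c} {y = y} ¬ret dd eq dy with ++-equidivisible y c (sym eq)
  ... | inj₁ (t′ , c≡ , _) = t′ , c≡
  ... | inj₂ (x , t′ , refl , e) with dyckPrefix-grafted c (x ∷ t′) dd dy (sym e)
  ...   | j , i , k≡ , pc , _ = ⊥-elim (¬ret (j , i , k≡ , pc))

  longest-grafted-cases : ∀ {d c k u s} → Dyck d → LongestDyckPrefix (Grafted d c k) u s →
      (∃[ t ] (c ≡ u ++ t × s ≡ t ++ d ++ D^ k))
    ⊎ (∃[ j ] ∃[ i ] (k ≡ j + i × Path 0 c j × u ≡ c ++ d ++ D^ j × s ≡ D^ i))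
  longest-grafted-cases {c = c} {u = u} dd L@(e , du , _) with ++-equidivisible u c (sym e)
  ... | inj₁ inside = inj₁ inside
  ... | inj₂ (x , t , refl , e′) with dyckPrefix-grafted c (x ∷ t) dd du (sym e′)
  ...   | j , i , refl , pc , _ = inj₂ (j , i , refl , pc , longestDyckPrefix-unique L (longest-grafted dd pc))

  longest-regraft : ∀ {e d′ c k u s} → Dyck (U ∷ e) → Dyck d′ →
    LongestDyckPrefix (Grafted (U ∷ e) c k) u s →
    ∃[ u′ ] ∃[ s′ ] (LongestDyckPrefix (Grafted d′ c k) u′ s′ × Regraft (U ∷ e) d′ (u ++ D ∷ s) (u′ ++ D ∷ s′))
  longest-regraft {e} {d′} {c} {k} {u} dd dd′ L@(_ , du , maxL) with longest-grafted-cases dd L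
  ... | inj₁ (t , refl , refl) =
    u , t ++ d′ ++ D^ k , (++-assoc u t (d′ ++ D^ k) , du , max) ,
    (u ++ D ∷ t , k , sym (++-assoc u (D ∷ t) _) , sym (++-assoc u (D ∷ t) _))
    where
    max : DyckPrefixes≤ (Grafted d′ (u ++ t) k) (length u)
    max y t₁ eq dy with ¬returns⇒dyckPrefix-inside (longest-inside⇒¬returns dd L) dd′ eq dy
    ... | t′ , c≡ = maxL y (t′ ++ U ∷ e ++ D^ k)
                      (trans (cong (_++ U ∷ e ++ D^ k) c≡) (++-assoc y t′ _)) dy
  ... | inj₂ (j , i , refl , pc , refl , refl) =
    c ++ d′ ++ D^ j , D^ i , longest-grafted dd′ pc ,
    (c , j + suc i , sym (grafted-+ (U ∷ e) c j (suc i)) , sym (grafted-+ d′ c j (suc i)))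

  greedyCover-regraft : ∀ {e e′ p c k r u s} → Dyck (U ∷ e) → Dyck (U ∷ e′) → Dyck (Grafted (U ∷ e′) (p ++ D ∷ c) k) →
    U ∷ r ≡ Grafted (U ∷ e) c k → LongestDyckPrefix (U ∷ r) u s →
    ∃[ w′ ] (GreedyCover (Grafted (U ∷ e′) (p ++ D ∷ c) k) w′ × Regraft (U ∷ e) (U ∷ e′) (p ++ u ++ D ∷ s) w′)
  greedyCover-regraft {e} {e′} {p} {c} {k} {u = u} {s} dd dd′ dg eU L
    with longest-regraft dd dd′ (subst (λ x → LongestDyckPrefix x u s) eU L) | head-preserved c (e′ ++ D^ k) eU
  ... | u′ , s′ , L′ , rg | r′ , eU′ =
    p ++ u′ ++ D ∷ s′ ,
    (dg , p , r′ , u′ , s′ , trans (++-assoc p (D ∷ c) _) (cong (λ x → p ++ D ∷ x) eU′) ,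
     subst (λ x → LongestDyckPrefix x u′ s′) eU′ L′ , refl) ,
    Regraft-++ˡ p rg

  greedyCover-graft : ∀ {d a k w} → Dyck (Grafted d a k) → GreedyCover d w → GreedyCover (Grafted d a k) (Grafted w a k)
  greedyCover-graft {a = a} {k} dg (dd , q , r , u , s , refl , L , refl) with path-++⁻ q dd
  ... | _ , _ , down pr =
    dg , a ++ q , r ++ D^ k , u , s ++ D^ k , grafted-++ , longest-++-D^ k pr L , grafted-swap a q u s k
    where
    grafted-++ : Grafted (q ++ D ∷ U ∷ r) a k ≡ (a ++ q) ++ D ∷ U ∷ r ++ D^ k
    grafted-++ = trans (cong (a ++_) (++-assoc q (D ∷ U ∷ r) (D^ k))) (sym (++-assoc a q _))

  greedyCover-grafted⁻ : ∀ {e a k w} → Dyck (U ∷ e) → Dyck (Grafted peak a k) → GreedyCover (Grafted (U ∷ e) a k) w →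
      (∃[ w₁ ] (GreedyCover (Grafted peak a k) w₁ × Regraft peak (U ∷ e) w₁ w))
    ⊎ (∃[ w₂ ] (GreedyCover (U ∷ e) w₂ × w ≡ Grafted w₂ a k))
  greedyCover-grafted⁻ {e} {a} {k} dd dv (_ , p , _ , _ , _ , eq , L , refl) with valley-grafted (U ∷ e) a p k eq
  ... | inj₁ (c , refl , eU) with greedyCover-regraft dd peak-dyck dv eU L
  ...   | w₁ , C₁ , rg = inj₁ (w₁ , C₁ , Regraft-sym rg)
  greedyCover-grafted⁻ {a = a} {k} dd dv (_ , p , r , u , s , eq , L , refl) | inj₂ (q , r′ , refl , e≡ , refl)
    with path-++⁻ q (subst Dyck e≡ dd)
  ... | _ , _ , down pr with longest-++-D^⁻ k pr L
  ...   | s′ , L′ , refl =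
    inj₂ (q ++ u ++ D ∷ s′ , (dd , q , r′ , u , s′ , e≡ , L′ , refl) , sym (grafted-swap a q u s′ k))

  greedyCover-regraft-peak : ∀ {e a k w₁} → Dyck (U ∷ e) → GreedyCover (Grafted peak a k) w₁ →
    ∃[ w ] (GreedyCover (Grafted (U ∷ e) a k) w × Regraft peak (U ∷ e) w₁ w)
  greedyCover-regraft-peak {a = a} {k} dd (dv , p , _ , _ , _ , eq , L , refl) with valley-grafted peak a p k eq
  ... | inj₁ (c , refl , eU) = greedyCover-regraft peak-dyck dd (grafted-path dv peak-dyck dd) eU L
  ... | inj₂ (q , _ , _ , e≡ , _) = ⊥-elim (U∷D^-has-no-valley m q e≡)

  NonEmptyDyck : List Step → Set
  NonEmptyDyck v = IsDyck m v × v ≢ []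

  cover⇒nonEmptyDyck : ∀ {v w} → Cover m v w → NonEmptyDyck w
  cover⇒nonEmptyDyck C@(_ , p , _ , u , s , _ , _ , _ , _ , refl) =
    dyck⇒isDyck (greedyCover-dyck (cover⇒greedyCover C)) ,
    λ e → D∷s≢[] (++-conicalʳ u (D ∷ s) (++-conicalʳ p (u ++ D ∷ s) e))
    where
    D∷s≢[] : D ∷ s ≢ []
    D∷s≢[] ()

  ins-decomposition : ∀ {v₁ v₂} → NonEmptyDyck v₁ → NonEmptyDyck v₂ →
    ∃[ a ] ∃[ k ] ∃[ e ] (v₁ ≡ Grafted peak a k × v₂ ≡ U ∷ e)
  ins-decomposition (d₁ , ne₁) (d₂ , ne₂) with last-peak (isDyck⇒dyck d₁) ne₁ | dyck-head (isDyck⇒dyck d₂) ne₂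
  ... | a , k , v₁≡ | e , v₂≡ = a , k , e , v₁≡ , v₂≡

  regraft-peak⇒ins : ∀ {d w₁ w} → Regraft peak d w₁ w → w ≡ ins m w₁ d
  regraft-peak⇒ins {d} (a , k , refl , refl) = sym (ins-grafted m a k d)

  cover-ins⁻ : ∀ {v₁ v₂ w} → NonEmptyDyck v₁ → NonEmptyDyck v₂ → Cover m (ins m v₁ v₂) w →
      (∃[ w₁ ] (Cover m v₁ w₁ × w ≡ ins m w₁ v₂)) ⊎ (∃[ w₂ ] (Cover m v₂ w₂ × w ≡ ins m v₁ w₂))
  cover-ins⁻ {w = w} ne₁@(d₁ , _) ne₂@(d₂ , _) C with ins-decomposition ne₁ ne₂
  ... | a , k , e , refl , refl
    with greedyCover-grafted⁻ (isDyck⇒dyck d₂) (isDyck⇒dyck d₁)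
           (cover⇒greedyCover (subst (λ v → Cover m v w) (ins-grafted m a k (U ∷ e)) C))
  ...   | inj₁ (w₁ , C₁ , rg)   = inj₁ (w₁ , greedyCover⇒cover C₁ , regraft-peak⇒ins rg)
  ...   | inj₂ (w₂ , C₂ , refl) = inj₂ (w₂ , greedyCover⇒cover C₂ , sym (ins-grafted m a k w₂))

  cover-insˡ : ∀ {v₁ v₂ w₁} → NonEmptyDyck v₁ → NonEmptyDyck v₂ → Cover m v₁ w₁ →
    Cover m (ins m v₁ v₂) (ins m w₁ v₂)
  cover-insˡ ne₁ ne₂@(d₂ , _) C with ins-decomposition ne₁ ne₂
  ... | a , k , e , refl , refl with greedyCover-regraft-peak (isDyck⇒dyck d₂) (cover⇒greedyCover C)
  ...   | _ , C′ , rg =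
    subst₂ (Cover m) (sym (ins-grafted m a k (U ∷ e))) (regraft-peak⇒ins rg) (greedyCover⇒cover C′)

  cover-insʳ : ∀ {v₁ v₂ w₂} → NonEmptyDyck v₁ → NonEmptyDyck v₂ → Cover m v₂ w₂ →
    Cover m (ins m v₁ v₂) (ins m v₁ w₂)
  cover-insʳ {w₂ = w₂} ne₁@(d₁ , _) ne₂@(d₂ , _) C with ins-decomposition ne₁ ne₂
  ... | a , k , e , refl , refl =
    subst₂ (Cover m) (sym (ins-grafted m a k (U ∷ e))) (sym (ins-grafted m a k w₂))
      (greedyCover⇒cover (greedyCover-graft dg (cover⇒greedyCover C)))
    where
    dg : Dyck (Grafted (U ∷ e) a k)
    dg = grafted-path (isDyck⇒dyck d₁) peak-dyck (isDyck⇒dyck d₂)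

proposition2p4 : (m : ℕ) → 1 ≤ m → (v₁ v₂ : List Step)
    → IsDyck m v₁ → IsDyck m v₂ → v₁ ≢ [] → v₂ ≢ []
    → ((w : List Step) → Cover m (ins m v₁ v₂) w
        → (∃[ w₁ ] (Cover m v₁ w₁ × w ≡ ins m w₁ v₂))
          ⊎ (∃[ w₂ ] (Cover m v₂ w₂ × w ≡ ins m v₁ w₂)))
    × ((w₁ : List Step) → Cover m v₁ w₁ → Cover m (ins m v₁ v₂) (ins m w₁ v₂))
    × ((w₂ : List Step) → Cover m v₂ w₂ → Cover m (ins m v₁ v₂) (ins m v₁ w₂))
    × ((w : List Step)
        → (ins m v₁ v₂ ≤[ m ] w
            → ∃[ w₁ ] ∃[ w₂ ] (v₁ ≤[ m ] w₁ × v₂ ≤[ m ] w₂ × w ≡ ins m w₁ w₂))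
        × (∃[ w₁ ] ∃[ w₂ ] (v₁ ≤[ m ] w₁ × v₂ ≤[ m ] w₂ × w ≡ ins m w₁ w₂)
            → ins m v₁ v₂ ≤[ m ] w))
proposition2p4 m _ v₁ v₂ d₁ d₂ ne₁ ne₂ =
  (λ _ → cover-ins⁻ nd₁ nd₂) , (λ _ → cover-insˡ nd₁ nd₂) , (λ _ → cover-insʳ nd₁ nd₂) ,
  λ _ → star-decompose NonEmptyDyck cover⇒nonEmptyDyck (ins m) cover-ins⁻ nd₁ nd₂ ,
        λ { (w₁ , w₂ , s₁ , s₂ , refl) → star-cong₂ NonEmptyDyck cover⇒nonEmptyDyck (ins m) cover-insˡ cover-insʳ nd₁ nd₂ s₁ s₂ }
  where
  open DyckPaths m
  nd₁ : NonEmptyDyck v₁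
  nd₁ = d₁ , ne₁
  nd₂ : NonEmptyDyck v₂
  nd₂ = d₂ , ne₂
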